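{- Let $b_1,\dots,b_n$ be points on a circle in clockwise order, let $I,J\subseteq[n]$ with $|I|=|J|$, and let $\pi:I\to J$ be a bijection with $\pi(i)=i$ for all $i\in I\cap J$. For $k,l\in I\setminus J$ with $k<l$, let $\pi^*:I\to J$ be defined by $\pi^*(k)=\pi(l)$, $\pi^*(l)=\pi(k)$ and $\pi^*(i)=\pi(i)$ otherwise. Then \[(-1)^{\operatorname{xing}(\pi^*)}=\begin{cases}(-1)^{\operatorname{xing}(\pi)+1} & \text{if }(k,l)\text{ is a crossing or an alignment of }\pi,\\ (-1)^{\operatorname{xing}(\pi)} & \text{if }(k,l)\text{ is a misalignment of }\pi.\end{cases}\]
   Context: Chords are straight segments between the points; two chords cross if they intersect in the interior of the disk. For $i_1<i_2$ in $I\setminus J$, consider the directed chords $b_{i_1}\to b_{\pi(i_1)}$ and $b_{i_2}\to b_{\pi(i_2)}$. The pair $(i_1,i_2)$ is a crossing of $\pi$ if these chords cross; an alignment if they do not cross and, going around the circle, the two starting points are cyclically adjacent among the four points (the chords are parallel and point in the same direction); and a misalignment if they do not cross and the four points alternate between starting points and endpoints around the circle (the chords are parallel and point in opposite directions). The crossing number $\operatorname{xing}(\pi)$ is the number of pairs $i_1<i_2$ in $I\setminus J$ that are crossings of $\pi$. -}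

module Defs where

open import Data.Nat using (ℕ; _<ᵇ_; _⊔_; _⊓_)
open import Data.Bool using (Bool; true; false; _∧_; _∨_; not; _xor_; if_then_else_)
open import Data.Fin using (Fin; toℕ; _≟_)
open import Data.Fin.Subset using (Subset)
open import Data.Vec using (lookup)
open import Data.List using (List; map; allFin)
open import Data.Nat.ListAction using (sum)
open import Relation.Binary.PropositionalEquality using (_≡_)
open import Relation.Nullary.Decidable using (⌊_⌋)

-- The points b_1,…,b_n lie on a circle in clockwise order; b_i is encoded by its
-- index i : Fin n.  Since the points are distinct and in cyclic order, everything
-- about straight chords between them is determined by the cyclic order of indices.

-- x lies strictly inside the arc of indices between a and b (the arc not
-- containing the "wrap-around" point between b_n and b_1).
between : ∀ {n} → Fin n → Fin n → Fin n → Bool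
between a b x = ((toℕ a ⊓ toℕ b) <ᵇ toℕ x) ∧ (toℕ x <ᵇ (toℕ a ⊔ toℕ b))

-- Chords a—b and c—d (four distinct points) cross in the interior of the disk
-- iff exactly one of c, d lies on each side of the chord a—b.
crossesᵇ : ∀ {n} → Fin n → Fin n → Fin n → Fin n → Bool
crossesᵇ a b c d = between a b c xor between a b d

-- Among the four points a,b,c,d, the points a and c are cyclically adjacent iff
-- the other two points b,d lie on the same arc cut out by a and c.
adjacentᵇ : ∀ {n} → Fin n → Fin n → Fin n → Fin n → Bool
adjacentᵇ a b c d = not (between a c b xor between a c d)

inDiffᵇ : ∀ {n} → Subset n → Subset n → Fin n → Bool
inDiffᵇ I J i = lookup I i ∧ not (lookup J i)

IsCrossing : ∀ {n} → (Fin n → Fin n) → Fin n → Fin n → Set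
IsCrossing π i₁ i₂ = crossesᵇ i₁ (π i₁) i₂ (π i₂) ≡ true

IsAlignment : ∀ {n} → (Fin n → Fin n) → Fin n → Fin n → Set
IsAlignment π i₁ i₂ =
  (not (crossesᵇ i₁ (π i₁) i₂ (π i₂)) ∧ adjacentᵇ i₁ (π i₁) i₂ (π i₂)) ≡ true

-- not crossing, and the four points alternate start/end around the circle
-- (i.e. the starting points are not cyclically adjacent)
IsMisalignment : ∀ {n} → (Fin n → Fin n) → Fin n → Fin n → Set
IsMisalignment π i₁ i₂ =
  (not (crossesᵇ i₁ (π i₁) i₂ (π i₂)) ∧ not (adjacentᵇ i₁ (π i₁) i₂ (π i₂))) ≡ true

xing : ∀ {n} → Subset n → Subset n → (Fin n → Fin n) → ℕ
xing {n} I J π =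
  sum (map (λ i₁ → sum (map (λ i₂ →
    if (toℕ i₁ <ᵇ toℕ i₂) ∧ inDiffᵇ I J i₁ ∧ inDiffᵇ I J i₂
         ∧ crossesᵇ i₁ (π i₁) i₂ (π i₂)
    then 1 else 0) (allFin n))) (allFin n))

swapAt : ∀ {n} → (Fin n → Fin n) → Fin n → Fin n → Fin n → Fin n
swapAt π k l i =
  if ⌊ i ≟ k ⌋ then π l else (if ⌊ i ≟ l ⌋ then π k else π i)

-- Swapping the values of π at two points k < l of I ∖ J changes the parity of
-- the crossing number exactly when the starting points k, l of the chords
-- k → π k and l → π l are cyclically adjacent, i.e. for crossings and
-- alignments but not for misalignments.
--
-- Points on the circle are compared through their indices: a point x
-- lies between a and b iff exactly one of a, b precedes x, so whether two
-- chords cross is the parity of four comparisons.  From this, Boolean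
-- identities (checked on truth tables) give the chord facts: crossing is
-- symmetric, exchanging the endpoints of two chords flips their crossing
-- status iff their starting points are adjacent, and crossing chords have
-- adjacent starting points.  The parity of xing is an exclusive-or over all
-- ordered pairs; splitting this double sum at k and l, the pairs avoiding
-- k, l are unchanged by the swap, the pairs with exactly one of k, l contribute
-- the same parity before and after (a chord meets the two chords at k, l in the
-- same four endpoints), and only the pair (k, l) itself can change.
module Submission where

open import Defs
open import Data.Nat using (ℕ; suc)
open import Data.Integer using (ℤ; -1ℤ; _^_)
open import Data.Fin using (Fin; _<_)
open import Data.Fin.Subset using (Subset; _∈_; _∉_; ∣_∣)
open import Data.Product using (_×_; ∃)
open import Data.Sum using (_⊎_)
open import Relation.Binary.PropositionalEquality using (_≡_)

open import Algebra.Bundles using (CommutativeRing)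
open import Data.Bool using (Bool; true; false; _∧_; not; _xor_; if_then_else_; T)
open import Data.Bool.Properties
  using (xor-comm; xor-identityʳ; ∧-distribˡ-xor; not-distribˡ-xor; T-∧; T-≡; xor-∧-commutativeRing)
  renaming (_≟_ to _≟ᵇ_)
open import Data.Fin using (toℕ; _≟_)
open import Data.Fin as Fin using ()
open import Data.Fin.Properties using (toℕ-injective)
open import Data.Integer using (1ℤ)
open import Data.List using (map; tabulate; allFin)
open import Data.List.Properties using (map-tabulate)
open import Data.Nat using (zero; _+_; _≤_; _<ᵇ_; _⊓_; _⊔_)
open import Data.Nat.ListAction using (sum)
open import Data.Nat.Properties
  using (<ᵇ-reflects-<; <ᵇ⇒<; <⇒<ᵇ; <⇒≯; <-irrefl; <-trans; ≤-<-trans; ≤-antisym; ≤-total; ≮⇒≥;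
         m≤n⇒m⊓n≡m; m≤n⇒m⊔n≡n; ⊓-comm; ⊔-comm)
open import Data.Product using (_,_; proj₁; proj₂)
open import Data.Sum using (inj₁; inj₂)
open import Data.Unit using (tt)
open import Data.Empty using (⊥-elim)
open import Data.Vec using (lookup)
open import Data.Vec.Properties using ([]=⇒lookup; lookup⇒[]=)
open import Function.Bundles using (Equivalence)
open import Relation.Nullary using (contradiction)
open import Relation.Nullary.Decidable using (⌊_⌋; yes; no; toWitness)
open import Relation.Nullary.Reflects using (ofʸ; ofⁿ)
open import Relation.Binary.PropositionalEquality
  using (_≢_; refl; sym; trans; cong; cong₂; subst; subst₂; ≢-sym; module ≡-Reasoning)

-- ⨁ f is the exclusive-or of f over Fin n: summation in the ring (Bool, xor, ∧).
open CommutativeRing xor-∧-commutativeRing using (semiring; +-commutativeMonoid)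
open import Algebra.Properties.Semiring.Sum semiring
  using (∑-distrib-+; sum-cong-≗; sum-replicate-zero)
  renaming (sum to ⨁)
open import Algebra.Solver.CommutativeMonoid +-commutativeMonoid using (solve; _⊜_; _⊕_)

BoolFun : ℕ → Set
BoolFun zero    = Bool
BoolFun (suc n) = Bool → BoolFun n

Identity : ∀ n → BoolFun n → BoolFun n → Set
Identity zero    x y = x ≡ y
Identity (suc n) f g = ∀ b → Identity n (f b) (g b)

agreeEverywhere : ∀ n → BoolFun n → BoolFun n → Bool
agreeEverywhere zero    x y = ⌊ x ≟ᵇ y ⌋
agreeEverywhere (suc n) f g =
  agreeEverywhere n (f true) (g true) ∧ agreeEverywhere n (f false) (g false)

truthTable : ∀ n (f g : BoolFun n) → T (agreeEverywhere n f g) → Identity n f g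
truthTable zero    x y ok = toWitness ok
truthTable (suc n) f g ok true  = truthTable n (f true) (g true) (proj₁ (Equivalence.to T-∧ ok))
truthTable (suc n) f g ok false = truthTable n (f false) (g false) (proj₂ (Equivalence.to T-∧ ok))

∧-guard : ∀ b {u v} → (b ≡ true → u ≡ v) → b ∧ u ≡ b ∧ v
∧-guard true  u≡v = u≡v refl
∧-guard false _   = refl

∧-right : ∀ {x y} → x ∧ y ≡ true → y ≡ true
∧-right {true} y≡true = y≡true

not-true : ∀ {x} → not x ≡ true → x ≡ false
not-true {false} _ = refl

forced : ∀ {h c a} → h ≡ true → c ≡ true → ((h ∧ c) ∧ not a) ≡ false → a ≡ true
forced {a = true}  refl refl _  = refl
forced {a = false} refl refl ()

∧-not-as-xor : ∀ {y z} → (T z → T y) → y ∧ not z ≡ y xor z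
∧-not-as-xor {true}  {true}  _   = refl
∧-not-as-xor {true}  {false} _   = refl
∧-not-as-xor {false} {true}  z⇒y = contradiction (z⇒y tt) λ ()
∧-not-as-xor {false} {false} _   = refl

_≺_ : ∀ {n} → Fin n → Fin n → Bool
a ≺ b = toℕ a <ᵇ toℕ b

≺-flip : ∀ {n} {a b : Fin n} → a ≢ b → (b ≺ a) ≡ not (a ≺ b)
≺-flip {a = a} {b} a≢b
  with toℕ a <ᵇ toℕ b | <ᵇ-reflects-< (toℕ a) (toℕ b)
     | toℕ b <ᵇ toℕ a | <ᵇ-reflects-< (toℕ b) (toℕ a)
... | true  | ofʸ a<b | true  | ofʸ b<a = contradiction b<a (<⇒≯ a<b)
... | true  | _       | false | _       = refl
... | false | _       | true  | _       = refl
... | false | ofⁿ a≮b | false | ofⁿ b≮a =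
  contradiction (toℕ-injective (≤-antisym (≮⇒≥ b≮a) (≮⇒≥ a≮b))) a≢b

≺-irrefl : ∀ {n} (a : Fin n) → (a ≺ a) ≡ false
≺-irrefl a with toℕ a <ᵇ toℕ a | <ᵇ-reflects-< (toℕ a) (toℕ a)
... | true  | ofʸ a<a = contradiction a<a (<-irrefl refl)
... | false | _       = refl

≺-trans : ∀ {n} {a b c : Fin n} → T (a ≺ b) → T (b ≺ c) → T (a ≺ c)
≺-trans {a = a} {b} {c} a≺b b≺c =
  <⇒<ᵇ (<-trans (<ᵇ⇒< (toℕ a) (toℕ b) a≺b) (<ᵇ⇒< (toℕ b) (toℕ c) b≺c))

between-ordered : ∀ {n} {a b x : Fin n} → toℕ a ≤ toℕ b → x ≢ b →
                  between a b x ≡ (a ≺ x) xor (b ≺ x)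
between-ordered {a = a} {b} {x} a≤b x≢b = begin
  between a b x                           ≡⟨ cong (λ m → (m <ᵇ toℕ x) ∧ (toℕ x <ᵇ (toℕ a ⊔ toℕ b))) (m≤n⇒m⊓n≡m a≤b) ⟩
  (a ≺ x) ∧ (toℕ x <ᵇ (toℕ a ⊔ toℕ b))   ≡⟨ cong (λ M → (a ≺ x) ∧ (toℕ x <ᵇ M)) (m≤n⇒m⊔n≡n a≤b) ⟩
  (a ≺ x) ∧ (x ≺ b)                       ≡⟨ cong ((a ≺ x) ∧_) (≺-flip (≢-sym x≢b)) ⟩
  (a ≺ x) ∧ not (b ≺ x)                   ≡⟨ ∧-not-as-xor (λ b≺x → <⇒<ᵇ (≤-<-trans a≤b (<ᵇ⇒< (toℕ b) (toℕ x) b≺x))) ⟩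
  (a ≺ x) xor (b ≺ x)                     ∎
  where open ≡-Reasoning

between-≺ : ∀ {n} {a b x : Fin n} → x ≢ a → x ≢ b → between a b x ≡ (a ≺ x) xor (b ≺ x)
between-≺ {a = a} {b} {x} x≢a x≢b with ≤-total (toℕ a) (toℕ b)
... | inj₁ a≤b = between-ordered a≤b x≢b
... | inj₂ b≤a = begin
  between a b x         ≡⟨ cong₂ (λ m M → (m <ᵇ toℕ x) ∧ (toℕ x <ᵇ M)) (⊓-comm (toℕ a) (toℕ b)) (⊔-comm (toℕ a) (toℕ b)) ⟩
  between b a x         ≡⟨ between-ordered b≤a x≢a ⟩
  (b ≺ x) xor (a ≺ x)   ≡⟨ xor-comm (b ≺ x) (a ≺ x) ⟩
  (a ≺ x) xor (b ≺ x)   ∎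
  where open ≡-Reasoning

record Distinct4 {n} (a b c d : Fin n) : Set where
  field
    a≢b : a ≢ b
    a≢c : a ≢ c
    a≢d : a ≢ d
    b≢c : b ≢ c
    b≢d : b ≢ d
    c≢d : c ≢ d

module _ {n} {a b c d : Fin n} (δ : Distinct4 a b c d) where
  open Distinct4 δ

  swap-chords : Distinct4 c d a b
  swap-chords = record { a≢b = c≢d ; a≢c = ≢-sym a≢c ; a≢d = ≢-sym b≢c
                       ; b≢c = ≢-sym a≢d ; b≢d = ≢-sym b≢d ; c≢d = a≢b }

  swap-ends : Distinct4 a d c b
  swap-ends = record { a≢b = a≢d ; a≢c = a≢c ; a≢d = a≢b
                     ; b≢c = ≢-sym c≢d ; b≢d = ≢-sym b≢d ; c≢d = ≢-sym b≢c }

  other-matching : Distinct4 a c b d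
  other-matching = record { a≢b = a≢c ; a≢c = a≢b ; a≢d = a≢d
                          ; b≢c = ≢-sym b≢c ; b≢d = c≢d ; c≢d = b≢d }

crosses-≺ : ∀ {n} {a b c d : Fin n} → Distinct4 a b c d →
            crossesᵇ a b c d ≡ ((a ≺ c) xor (b ≺ c)) xor ((a ≺ d) xor (b ≺ d))
crosses-≺ δ = cong₂ _xor_ (between-≺ (≢-sym a≢c) (≢-sym b≢c)) (between-≺ (≢-sym a≢d) (≢-sym b≢d))
  where open Distinct4 δ

crosses-sym : ∀ {n} {a b c d : Fin n} → Distinct4 a b c d →
              crossesᵇ a b c d ≡ crossesᵇ c d a b
crosses-sym {a = a} {b} {c} {d} δ = begin
  crossesᵇ a b c d                                               ≡⟨ crosses-≺ δ ⟩
  ((a ≺ c) xor (b ≺ c)) xor ((a ≺ d) xor (b ≺ d))                 ≡⟨ truthTable 4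
     (λ ac bc ad bd → (ac xor bc) xor (ad xor bd))
     (λ ac bc ad bd → (not ac xor not ad) xor (not bc xor not bd)) tt (a ≺ c) (b ≺ c) (a ≺ d) (b ≺ d) ⟩
  (not (a ≺ c) xor not (a ≺ d)) xor (not (b ≺ c) xor not (b ≺ d)) ≡⟨ sym (cong₂ _xor_ (cong₂ _xor_ (≺-flip a≢c) (≺-flip a≢d)) (cong₂ _xor_ (≺-flip b≢c) (≺-flip b≢d))) ⟩
  ((c ≺ a) xor (d ≺ a)) xor ((c ≺ b) xor (d ≺ b))                 ≡⟨ sym (crosses-≺ (swap-chords δ)) ⟩
  crossesᵇ c d a b                                               ∎
  where open ≡-Reasoning
        open Distinct4 δ

adjacent-≺ : ∀ {n} {a b c d : Fin n} → Distinct4 a b c d →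
             adjacentᵇ a b c d ≡ not (((a ≺ b) xor not (b ≺ c)) xor ((a ≺ d) xor (c ≺ d)))
adjacent-≺ {a = a} {b} {c} {d} δ =
  trans (cong not (crosses-≺ (other-matching δ)))
        (cong (λ cb → not (((a ≺ b) xor cb) xor ((a ≺ d) xor (c ≺ d)))) (≺-flip b≢c))
  where open Distinct4 δ

-- A chord x—y crosses the chords k—q and l—p as often (mod 2) as it crosses
-- k—p and l—q: both counts only see which of k, l, p, q lie between x and y.
exchanged-ends : ∀ {n} (x y k l p q : Fin n) →
                 (crossesᵇ x y k q xor crossesᵇ x y l p) ≡ (crossesᵇ x y k p xor crossesᵇ x y l q)
exchanged-ends x y k l p q =
  solve 4 (λ K L P Q → ((K ⊕ Q) ⊕ (L ⊕ P)) ⊜ ((K ⊕ P) ⊕ (L ⊕ Q))) refl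
    (between x y k) (between x y l) (between x y p) (between x y q)

-- Exchanging the endpoints of chords a—b and c—d changes whether they cross
-- exactly when a and c are adjacent among the four points.  (Equivalently: an
-- odd number of the three ways to pair up four points give crossing chords.)
exchange-crossing : ∀ {n} {a b c d : Fin n} → Distinct4 a b c d →
                    crossesᵇ a d c b ≡ crossesᵇ a b c d xor adjacentᵇ a b c d
exchange-crossing {a = a} {b} {c} {d} δ = begin
  crossesᵇ a d c b
    ≡⟨ crosses-≺ (swap-ends δ) ⟩
  ((a ≺ c) xor (d ≺ c)) xor ((a ≺ b) xor (d ≺ b))
    ≡⟨ cong₂ (λ dc db → ((a ≺ c) xor dc) xor ((a ≺ b) xor db)) (≺-flip c≢d) (≺-flip b≢d) ⟩
  ((a ≺ c) xor not (c ≺ d)) xor ((a ≺ b) xor not (b ≺ d))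
    ≡⟨ truthTable 6
         (λ ab ac ad bc bd cd → (ac xor not cd) xor (ab xor not bd))
         (λ ab ac ad bc bd cd → ((ac xor bc) xor (ad xor bd)) xor not ((ab xor not bc) xor (ad xor cd)))
         tt (a ≺ b) (a ≺ c) (a ≺ d) (b ≺ c) (b ≺ d) (c ≺ d) ⟩
  (((a ≺ c) xor (b ≺ c)) xor ((a ≺ d) xor (b ≺ d))) xor not (((a ≺ b) xor not (b ≺ c)) xor ((a ≺ d) xor (c ≺ d)))
    ≡⟨ sym (cong₂ _xor_ (crosses-≺ δ) (adjacent-≺ δ)) ⟩
  crossesᵇ a b c d xor adjacentᵇ a b c d ∎
  where open ≡-Reasoning
        open Distinct4 δ

-- The comparison bits of three distinct points p, q, r contain no cycle:
-- neither p ≺ q ≺ r ≺ p nor r ≺ q ≺ p ≺ r.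
acyclic : Bool → Bool → Bool → Bool
acyclic pq qr pr = not (pq ∧ qr ∧ not pr) ∧ not (not pq ∧ not qr ∧ pr)

≺-acyclic : ∀ {n} {p q r : Fin n} → p ≢ q → q ≢ r → p ≢ r → acyclic (p ≺ q) (q ≺ r) (p ≺ r) ≡ true
≺-acyclic {p = p} {q} {r} p≢q q≢r p≢r with p ≺ q in pq | q ≺ r in qr | p ≺ r in pr
... | true  | true  | false = ⊥-elim (subst T pr p≺r)
  where p≺r : T (p ≺ r)
        p≺r = ≺-trans {a = p} {q} {r} (Equivalence.from T-≡ pq) (Equivalence.from T-≡ qr)
... | false | false | true  = ⊥-elim (subst T (trans (≺-flip p≢r) (cong not pr)) r≺p)
  where r≺p : T (r ≺ p)
        r≺p = ≺-trans {a = r} {q} {p} (Equivalence.from T-≡ (trans (≺-flip q≢r) (cong not qr)))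
                                      (Equivalence.from T-≡ (trans (≺-flip p≢q) (cong not pq)))
... | true  | true  | true  = refl
... | true  | false | _     = refl
... | false | true  | _     = refl
... | false | false | false = refl

-- Crossing chords a—b and c—d have cyclically adjacent starting points a, c
-- (of the three pairings of four points, at most one crosses).
crossing⇒adjacent : ∀ {n} {a b c d : Fin n} → Distinct4 a b c d →
                    crossesᵇ a b c d ≡ true → adjacentᵇ a b c d ≡ true
crossing⇒adjacent {a = a} {b} {c} {d} δ cross =
  subst (_≡ true) (sym (adjacent-≺ δ))
        (forced linear (trans (sym (crosses-≺ δ)) cross) noCycleAndCrossing)
  where
    open Distinct4 δ
    linear : (acyclic (a ≺ b) (b ≺ c) (a ≺ c) ∧ acyclic (a ≺ b) (b ≺ d) (a ≺ d)
              ∧ acyclic (a ≺ c) (c ≺ d) (a ≺ d) ∧ acyclic (b ≺ c) (c ≺ d) (b ≺ d)) ≡ true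
    linear rewrite ≺-acyclic a≢b b≢c a≢c | ≺-acyclic a≢b b≢d a≢d
                 | ≺-acyclic a≢c c≢d a≢d | ≺-acyclic b≢c c≢d b≢d = refl
    noCycleAndCrossing :
      ((acyclic (a ≺ b) (b ≺ c) (a ≺ c) ∧ acyclic (a ≺ b) (b ≺ d) (a ≺ d)
        ∧ acyclic (a ≺ c) (c ≺ d) (a ≺ d) ∧ acyclic (b ≺ c) (c ≺ d) (b ≺ d))
       ∧ (((a ≺ c) xor (b ≺ c)) xor ((a ≺ d) xor (b ≺ d))))
      ∧ not (not (((a ≺ b) xor not (b ≺ c)) xor ((a ≺ d) xor (c ≺ d)))) ≡ false
    noCycleAndCrossing = truthTable 6
      (λ ab ac ad bc bd cd →
         ((acyclic ab bc ac ∧ acyclic ab bd ad ∧ acyclic ac cd ad ∧ acyclic bc cd bd)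
          ∧ ((ac xor bc) xor (ad xor bd))) ∧ not (not ((ab xor not bc) xor (ad xor cd))))
      (λ _ _ _ _ _ _ → false)
      tt (a ≺ b) (a ≺ c) (a ≺ d) (b ≺ c) (b ≺ d) (c ≺ d)

⨁-guarded-xor : ∀ {n} (g f h : Fin n → Bool) →
                ⨁ (λ i → g i ∧ (f i xor h i)) ≡ ⨁ (λ i → g i ∧ f i) xor ⨁ (λ i → g i ∧ h i)
⨁-guarded-xor g f h =
  trans (sum-cong-≗ (λ i → ∧-distribˡ-xor (g i) (f i) (h i))) (∑-distrib-+ (λ i → g i ∧ f i) (λ i → g i ∧ h i))

-- Equality tests commute with suc (the test on suc's is a mapped Dec).
≟-suc : ∀ {n} (i k : Fin n) → ⌊ Fin.suc i ≟ Fin.suc k ⌋ ≡ ⌊ i ≟ k ⌋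
≟-suc i k with i ≟ k
... | yes _ = refl
... | no _  = refl

⨁-point : ∀ {n} (k : Fin n) b → ⨁ (λ i → ⌊ i ≟ k ⌋ ∧ b) ≡ b
⨁-point {suc n} Fin.zero    b = trans (cong (b xor_) (sum-replicate-zero n)) (xor-identityʳ b)
⨁-point {suc n} (Fin.suc k) b =
  trans (sum-cong-≗ (λ i → cong (_∧ b) (≟-suc i k))) (⨁-point k b)

module TwoIndices {n} {k l : Fin n} (k≢l : k ≢ l) where

  away : Fin n → Bool
  away i = not ⌊ i ≟ k ⌋ ∧ not ⌊ i ≟ l ⌋

  ⨁-split : ∀ (F : Fin n → Bool) → ⨁ F ≡ F k xor (F l xor ⨁ (λ i → away i ∧ F i))
  ⨁-split F = begin
    ⨁ F
      ≡⟨ sum-cong-≗ pointwise ⟩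
    ⨁ (λ i → (⌊ i ≟ k ⌋ ∧ F k) xor ((⌊ i ≟ l ⌋ ∧ F l) xor (away i ∧ F i)))
      ≡⟨ ∑-distrib-+ (λ i → ⌊ i ≟ k ⌋ ∧ F k) (λ i → (⌊ i ≟ l ⌋ ∧ F l) xor (away i ∧ F i)) ⟩
    ⨁ (λ i → ⌊ i ≟ k ⌋ ∧ F k) xor ⨁ (λ i → (⌊ i ≟ l ⌋ ∧ F l) xor (away i ∧ F i))
      ≡⟨ cong₂ _xor_ (⨁-point k (F k))
           (trans (∑-distrib-+ (λ i → ⌊ i ≟ l ⌋ ∧ F l) (λ i → away i ∧ F i))
                  (cong (_xor ⨁ (λ i → away i ∧ F i)) (⨁-point l (F l)))) ⟩
    F k xor (F l xor ⨁ (λ i → away i ∧ F i)) ∎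
    where
      open ≡-Reasoning
      pointwise : ∀ i → F i ≡ (⌊ i ≟ k ⌋ ∧ F k) xor ((⌊ i ≟ l ⌋ ∧ F l) xor (away i ∧ F i))
      pointwise i with i ≟ k | i ≟ l
      ... | yes refl | yes i≡l = contradiction i≡l k≢l
      ... | yes refl | no _    = sym (xor-identityʳ (F k))
      ... | no _     | yes refl = sym (xor-identityʳ (F l))
      ... | no _     | no _    = refl

  corner : (Fin n → Fin n → Bool) → Bool
  corner M = (M k k xor M k l) xor (M l k xor M l l)

  star : (Fin n → Fin n → Bool) → Fin n → Bool
  star M x = (M x k xor M k x) xor (M x l xor M l x)

  interior : (Fin n → Fin n → Bool) → Bool
  interior M = ⨁ (λ x → away x ∧ ⨁ (λ y → away y ∧ M x y))

  ⨁⨁-split : ∀ (M : Fin n → Fin n → Bool) →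
             ⨁ (λ i → ⨁ (M i)) ≡ corner M xor (⨁ (λ x → away x ∧ star M x) xor interior M)
  ⨁⨁-split M = begin
    ⨁ (λ i → ⨁ (M i))
      ≡⟨ ⨁-split (λ i → ⨁ (M i)) ⟩
    ⨁ (M k) xor (⨁ (M l) xor ⨁ (λ x → away x ∧ ⨁ (M x)))
      ≡⟨ cong₂ _xor_ (⨁-split (M k)) (cong₂ _xor_ (⨁-split (M l))
           (sum-cong-≗ (λ x → cong (away x ∧_) (⨁-split (M x))))) ⟩
    (M k k xor (M k l xor Rk)) xor ((M l k xor (M l l xor Rl))
      xor ⨁ (λ x → away x ∧ (M x k xor (M x l xor ⨁ (λ y → away y ∧ M x y)))))
      ≡⟨ cong (λ z → (M k k xor (M k l xor Rk)) xor ((M l k xor (M l l xor Rl)) xor z))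
           (trans (⨁-guarded-xor away _ _) (cong (Ck xor_) (⨁-guarded-xor away _ _))) ⟩
    (M k k xor (M k l xor Rk)) xor ((M l k xor (M l l xor Rl)) xor (Ck xor (Cl xor interior M)))
      ≡⟨ solve 9 (λ kk kl lk ll rk rl ck cl int →
           ((kk ⊕ (kl ⊕ rk)) ⊕ ((lk ⊕ (ll ⊕ rl)) ⊕ (ck ⊕ (cl ⊕ int))))
           ⊜ (((kk ⊕ kl) ⊕ (lk ⊕ ll)) ⊕ (((ck ⊕ rk) ⊕ (cl ⊕ rl)) ⊕ int)))
           refl (M k k) (M k l) (M l k) (M l l) Rk Rl Ck Cl (interior M) ⟩
    corner M xor (((Ck xor Rk) xor (Cl xor Rl)) xor interior M)
      ≡⟨ cong (λ z → corner M xor (z xor interior M)) (sym starSum) ⟩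
    corner M xor (⨁ (λ x → away x ∧ star M x) xor interior M) ∎
    where
      open ≡-Reasoning
      Rk Rl Ck Cl : Bool
      Rk = ⨁ (λ x → away x ∧ M k x)
      Rl = ⨁ (λ x → away x ∧ M l x)
      Ck = ⨁ (λ x → away x ∧ M x k)
      Cl = ⨁ (λ x → away x ∧ M x l)
      starSum : ⨁ (λ x → away x ∧ star M x) ≡ (Ck xor Rk) xor (Cl xor Rl)
      starSum = trans (⨁-guarded-xor away _ _)
                      (cong₂ _xor_ (⨁-guarded-xor away _ _) (⨁-guarded-xor away _ _))

odd : ℕ → Bool
odd zero    = false
odd (suc m) = not (odd m)

odd-+ : ∀ m m′ → odd (m + m′) ≡ odd m xor odd m′
odd-+ zero    m′ = refl
odd-+ (suc m) m′ = trans (cong not (odd-+ m m′)) (not-distribˡ-xor (odd m) (odd m′))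

odd-indicator : ∀ b → odd (if b then 1 else 0) ≡ b
odd-indicator true  = refl
odd-indicator false = refl

odd-sum : ∀ n (g : Fin n → ℕ) → odd (sum (map g (allFin n))) ≡ ⨁ (λ i → odd (g i))
odd-sum n g = trans (cong (λ xs → odd (sum xs)) (map-tabulate (λ i → i) g)) (odd-tabulate n g)
  where
    odd-tabulate : ∀ m (h : Fin m → ℕ) → odd (sum (tabulate h)) ≡ ⨁ (λ i → odd (h i))
    odd-tabulate zero    h = refl
    odd-tabulate (suc m) h = trans (odd-+ (h Fin.zero) (sum (tabulate (λ i → h (Fin.suc i)))))
                                   (cong (odd (h Fin.zero) xor_) (odd-tabulate m (λ i → h (Fin.suc i))))

sign-by-parity : ∀ m → -1ℤ ^ m ≡ (if odd m then -1ℤ else 1ℤ)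
sign-by-parity zero = refl
sign-by-parity (suc m) rewrite sign-by-parity m with odd m
... | true  = refl
... | false = refl

same-sign : ∀ m m′ → odd m ≡ odd m′ → -1ℤ ^ m ≡ -1ℤ ^ m′
same-sign m m′ eq =
  trans (sign-by-parity m) (trans (cong (if_then -1ℤ else 1ℤ) eq) (sym (sign-by-parity m′)))

inDiff⁺ : ∀ {n} {I J : Subset n} {i} → i ∈ I → i ∉ J → inDiffᵇ I J i ≡ true
inDiff⁺ {I = I} {J} {i} i∈I i∉J with lookup J i in eJ
... | true  = contradiction (lookup⇒[]= i J eJ) i∉J
... | false = cong (_∧ true) ([]=⇒lookup i∈I)

inDiff⁻ : ∀ {n} {I J : Subset n} {i} → inDiffᵇ I J i ≡ true → i ∈ I × i ∉ J
inDiff⁻ {I = I} {J} {i} d with lookup I i in eI | lookup J i in eJ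
inDiff⁻ {I = I} {J} {i} () | false | _
inDiff⁻ {I = I} {J} {i} () | true  | true
... | true | false = lookup⇒[]= i I eI , λ i∈J → contradiction (trans (sym ([]=⇒lookup i∈J)) eJ) λ ()

crossingTerm : ∀ {n} → Subset n → Subset n → (Fin n → Fin n) → Fin n → Fin n → Bool
crossingTerm I J f i j = (i ≺ j) ∧ inDiffᵇ I J i ∧ inDiffᵇ I J j ∧ crossesᵇ i (f i) j (f j)

xing-parity : ∀ {n} (I J : Subset n) (f : Fin n → Fin n) →
              odd (xing I J f) ≡ ⨁ (λ i → ⨁ (λ j → crossingTerm I J f i j))
xing-parity {n} I J f =
  trans (odd-sum n λ i → sum (map (λ j → if crossingTerm I J f i j then 1 else 0) (allFin n)))
        (sum-cong-≗ λ i → trans (odd-sum n λ j → if crossingTerm I J f i j then 1 else 0)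
                                (sum-cong-≗ λ j → odd-indicator (crossingTerm I J f i j)))

crossingTerm-pair : ∀ {n} (I J : Subset n) (f : Fin n → Fin n) {i j} → i ≢ j →
  (inDiffᵇ I J i ≡ true → inDiffᵇ I J j ≡ true → Distinct4 i (f i) j (f j)) →
  (crossingTerm I J f i j xor crossingTerm I J f j i)
    ≡ inDiffᵇ I J i ∧ inDiffᵇ I J j ∧ crossesᵇ i (f i) j (f j)
crossingTerm-pair I J f {i} {j} i≢j distinct with i ≺ j in ij
... | true  rewrite trans (≺-flip i≢j) (cong not ij) = xor-identityʳ _
... | false rewrite trans (≺-flip i≢j) (cong not ij)
  with inDiffᵇ I J i | inDiffᵇ I J j
...   | true  | true  = sym (crosses-sym (distinct refl refl))
...   | true  | false = refl
...   | false | true  = refl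
...   | false | false = refl

module Exchange {n} (I J : Subset n) (π : Fin n → Fin n)
  (π∈J : ∀ i → i ∈ I → π i ∈ J)
  (π-inj : ∀ i j → i ∈ I → j ∈ I → π i ≡ π j → i ≡ j)
  {k l : Fin n} (k∈I : k ∈ I) (k∉J : k ∉ J) (l∈I : l ∈ I) (l∉J : l ∉ J) (k<l : k < l) where

  D : Fin n → Bool
  D = inDiffᵇ I J

  term : (Fin n → Fin n) → Fin n → Fin n → Bool
  term = crossingTerm I J

  π* : Fin n → Fin n
  π* = swapAt π k l

  k≢l : k ≢ l
  k≢l k≡l = <-irrefl (cong toℕ k≡l) k<l

  open TwoIndices k≢l

  π*-at-k : π* k ≡ π l
  π*-at-k with k ≟ k
  ... | yes _   = refl
  ... | no k≢k = contradiction refl k≢k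

  π*-at-l : π* l ≡ π k
  π*-at-l with l ≟ k | l ≟ l
  ... | no _    | yes _   = refl
  ... | yes l≡k | _       = contradiction (sym l≡k) k≢l
  ... | no _    | no l≢l = contradiction refl l≢l

  away⇒≢ : ∀ {x} → away x ≡ true → x ≢ k × x ≢ l
  away⇒≢ {x} h with x ≟ k | x ≟ l
  ... | no x≢k | no x≢l = x≢k , x≢l
  away⇒≢ {x} () | yes _ | _
  away⇒≢ {x} () | no _  | yes _

  π*-away : ∀ {x} → away x ≡ true → π* x ≡ π x
  π*-away {x} h with x ≟ k | x ≟ l
  ... | no _ | no _ = refl
  π*-away {x} () | yes _ | _
  π*-away {x} () | no _  | yes _

  D-k : D k ≡ true
  D-k = inDiff⁺ k∈I k∉J

  D-l : D l ≡ true
  D-l = inDiff⁺ l∈I l∉J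

  ∉J⇒≢π : ∀ {a} y → a ∉ J → y ∈ I → a ≢ π y
  ∉J⇒≢π y a∉J y∈I a≡πy = a∉J (subst (_∈ J) (sym a≡πy) (π∈J y y∈I))

  chord-ends : ∀ {i j y} → D i ≡ true → D j ≡ true → y ∈ I → i ≢ j → i ≢ y →
               Distinct4 i (π i) j (π y)
  chord-ends {i} {j} {y} di dj y∈I i≢j i≢y = record
    { a≢b = ∉J⇒≢π i (proj₂ i∈I∖J) (proj₁ i∈I∖J)
    ; a≢c = i≢j
    ; a≢d = ∉J⇒≢π y (proj₂ i∈I∖J) y∈I
    ; b≢c = ≢-sym (∉J⇒≢π i (proj₂ j∈I∖J) (proj₁ i∈I∖J))
    ; b≢d = λ πi≡πy → i≢y (π-inj i y (proj₁ i∈I∖J) y∈I πi≡πy)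
    ; c≢d = ∉J⇒≢π y (proj₂ j∈I∖J) y∈I
    }
    where
      i∈I∖J : i ∈ I × i ∉ J
      i∈I∖J = inDiff⁻ {I = I} {J} di
      j∈I∖J : j ∈ I × j ∉ J
      j∈I∖J = inDiff⁻ {I = I} {J} dj

  corner-term : ∀ f → corner (term f) ≡ crossesᵇ k (f k) l (f l)
  corner-term f = begin
    corner (term f)
      ≡⟨ cong₂ _xor_ (cong₂ _xor_ (diagonal k) term-kl) (cong₂ _xor_ term-lk (diagonal l)) ⟩
    (false xor crossesᵇ k (f k) l (f l)) xor (false xor false)
      ≡⟨ xor-identityʳ _ ⟩
    crossesᵇ k (f k) l (f l) ∎
    where
      open ≡-Reasoning
      diagonal : ∀ x → term f x x ≡ false
      diagonal x = cong (_∧ (D x ∧ D x ∧ crossesᵇ x (f x) x (f x))) (≺-irrefl x)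
      term-lk : term f l k ≡ false
      term-lk = cong (_∧ (D l ∧ D k ∧ crossesᵇ l (f l) k (f k)))
                     (trans (≺-flip k≢l) (cong not (Equivalence.to T-≡ (<⇒<ᵇ k<l))))
      term-kl : term f k l ≡ crossesᵇ k (f k) l (f l)
      term-kl = cong₃ (λ kl dk dl → kl ∧ dk ∧ dl ∧ crossesᵇ k (f k) l (f l))
                      (Equivalence.to T-≡ (<⇒<ᵇ k<l)) D-k D-l
        where cong₃ : ∀ (g : Bool → Bool → Bool → Bool) {a a′ b b′ c c′} →
                      a ≡ a′ → b ≡ b′ → c ≡ c′ → g a b c ≡ g a′ b′ c′
              cong₃ g refl refl refl = refl

  star-term : ∀ f {x} → away x ≡ true →
    (D x ≡ true → Distinct4 x (f x) k (f k)) → (D x ≡ true → Distinct4 x (f x) l (f l)) →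
    star (term f) x ≡ D x ∧ (crossesᵇ x (f x) k (f k) xor crossesᵇ x (f x) l (f l))
  star-term f {x} h δk δl = begin
    star (term f) x
      ≡⟨ cong₂ _xor_ (crossingTerm-pair I J f (proj₁ (away⇒≢ h)) (λ dx _ → δk dx))
                     (crossingTerm-pair I J f (proj₂ (away⇒≢ h)) (λ dx _ → δl dx)) ⟩
    (D x ∧ D k ∧ crossesᵇ x (f x) k (f k)) xor (D x ∧ D l ∧ crossesᵇ x (f x) l (f l))
      ≡⟨ cong₂ (λ dk dl → (D x ∧ dk ∧ crossesᵇ x (f x) k (f k)) xor (D x ∧ dl ∧ crossesᵇ x (f x) l (f l))) D-k D-l ⟩
    (D x ∧ crossesᵇ x (f x) k (f k)) xor (D x ∧ crossesᵇ x (f x) l (f l))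
      ≡⟨ sym (∧-distribˡ-xor (D x) _ _) ⟩
    D x ∧ (crossesᵇ x (f x) k (f k) xor crossesᵇ x (f x) l (f l)) ∎
    where open ≡-Reasoning

  star-unchanged : ∀ x → away x ∧ star (term π*) x ≡ away x ∧ star (term π) x
  star-unchanged x = ∧-guard (away x) λ h →
    let (x≢k , x≢l) = away⇒≢ h in begin
    star (term π*) x
      ≡⟨ star-term π* h
           (λ dx → subst₂ (λ u v → Distinct4 x u k v) (sym (π*-away h)) (sym π*-at-k) (chord-ends dx D-k l∈I x≢k x≢l))
           (λ dx → subst₂ (λ u v → Distinct4 x u l v) (sym (π*-away h)) (sym π*-at-l) (chord-ends dx D-l k∈I x≢l x≢k)) ⟩
    D x ∧ (crossesᵇ x (π* x) k (π* k) xor crossesᵇ x (π* x) l (π* l))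
      ≡⟨ cong (λ u → D x ∧ (crossesᵇ x u k (π* k) xor crossesᵇ x u l (π* l))) (π*-away h) ⟩
    D x ∧ (crossesᵇ x (π x) k (π* k) xor crossesᵇ x (π x) l (π* l))
      ≡⟨ cong₂ (λ p q → D x ∧ (crossesᵇ x (π x) k p xor crossesᵇ x (π x) l q)) π*-at-k π*-at-l ⟩
    D x ∧ (crossesᵇ x (π x) k (π l) xor crossesᵇ x (π x) l (π k))
      ≡⟨ cong (D x ∧_) (exchanged-ends x (π x) k l (π k) (π l)) ⟩
    D x ∧ (crossesᵇ x (π x) k (π k) xor crossesᵇ x (π x) l (π l))
      ≡⟨ sym (star-term π h (λ dx → chord-ends dx D-k k∈I x≢k x≢k) (λ dx → chord-ends dx D-l l∈I x≢l x≢l)) ⟩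
    star (term π) x ∎
    where open ≡-Reasoning

  interior-unchanged : interior (term π*) ≡ interior (term π)
  interior-unchanged =
    sum-cong-≗ λ x → ∧-guard (away x) λ hx → sum-cong-≗ λ y → ∧-guard (away y) λ hy →
      cong₂ (λ u v → (x ≺ y) ∧ D x ∧ D y ∧ crossesᵇ x u y v) (π*-away hx) (π*-away hy)

  parity-change : odd (xing I J π*) ≡ odd (xing I J π) xor adjacentᵇ k (π k) l (π l)
  parity-change = begin
    odd (xing I J π*)
      ≡⟨ trans (xing-parity I J π*) (⨁⨁-split (term π*)) ⟩
    corner (term π*) xor (⨁ (λ x → away x ∧ star (term π*) x) xor interior (term π*))
      ≡⟨ cong₂ _xor_ (corner-term π*) (cong₂ _xor_ (sum-cong-≗ star-unchanged) interior-unchanged) ⟩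
    crossesᵇ k (π* k) l (π* l) xor rest
      ≡⟨ cong₂ (λ p q → crossesᵇ k p l q xor rest) π*-at-k π*-at-l ⟩
    crossesᵇ k (π l) l (π k) xor rest
      ≡⟨ cong (_xor rest) (exchange-crossing (chord-ends D-k D-l l∈I k≢l k≢l)) ⟩
    (crossesᵇ k (π k) l (π l) xor adj) xor rest
      ≡⟨ solve 3 (λ c a r → ((c ⊕ a) ⊕ r) ⊜ ((c ⊕ r) ⊕ a)) refl (crossesᵇ k (π k) l (π l)) adj rest ⟩
    (crossesᵇ k (π k) l (π l) xor rest) xor adj
      ≡⟨ cong (λ c → (c xor rest) xor adj) (sym (corner-term π)) ⟩
    (corner (term π) xor rest) xor adj
      ≡⟨ cong (_xor adj) (sym (trans (xing-parity I J π) (⨁⨁-split (term π)))) ⟩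
    odd (xing I J π) xor adj ∎
    where
      open ≡-Reasoning
      adj rest : Bool
      adj = adjacentᵇ k (π k) l (π l)
      rest = ⨁ (λ x → away x ∧ star (term π) x) xor interior (term π)

  adjacent : IsCrossing π k l ⊎ IsAlignment π k l → adjacentᵇ k (π k) l (π l) ≡ true
  adjacent (inj₁ crossing)  = crossing⇒adjacent (chord-ends D-k D-l l∈I k≢l k≢l) crossing
  adjacent (inj₂ alignment) = ∧-right alignment

  not-adjacent : IsMisalignment π k l → adjacentᵇ k (π k) l (π l) ≡ false
  not-adjacent misalignment = not-true (∧-right misalignment)

lemma2p13 : (n : ℕ) (I J : Subset n) → ∣ I ∣ ≡ ∣ J ∣ →
    (π : Fin n → Fin n) →
    (∀ i → i ∈ I → π i ∈ J) →
    (∀ i j → i ∈ I → j ∈ I → π i ≡ π j → i ≡ j) →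
    (∀ j → j ∈ J → ∃ λ i → i ∈ I × π i ≡ j) →
    (∀ i → i ∈ I → i ∈ J → π i ≡ i) →
    (k l : Fin n) → k ∈ I → k ∉ J → l ∈ I → l ∉ J → k < l →
    ((IsCrossing π k l ⊎ IsAlignment π k l) →
        -1ℤ ^ xing I J (swapAt π k l) ≡ -1ℤ ^ suc (xing I J π))
    × (IsMisalignment π k l →
        -1ℤ ^ xing I J (swapAt π k l) ≡ -1ℤ ^ xing I J π)
lemma2p13 n I J _ π π∈J π-inj _ _ k l k∈I k∉J l∈I l∉J k<l =
  (λ crossingOrAlignment → same-sign (xing I J π*) (suc (xing I J π)) (begin
     odd (xing I J π*)                     ≡⟨ parity-change ⟩
     odd (xing I J π) xor adjacentᵇ k (π k) l (π l) ≡⟨ cong (odd (xing I J π) xor_) (adjacent crossingOrAlignment) ⟩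
     odd (xing I J π) xor true             ≡⟨ xor-comm (odd (xing I J π)) true ⟩
     odd (suc (xing I J π))                ∎)) ,
  (λ misalignment → same-sign (xing I J π*) (xing I J π) (begin
     odd (xing I J π*)                     ≡⟨ parity-change ⟩
     odd (xing I J π) xor adjacentᵇ k (π k) l (π l) ≡⟨ cong (odd (xing I J π) xor_) (not-adjacent misalignment) ⟩
     odd (xing I J π) xor false            ≡⟨ xor-identityʳ _ ⟩
     odd (xing I J π)                      ∎))
  where
    open Exchange I J π π∈J π-inj k∈I k∉J l∈I l∉J k<l
    open ≡-Reasoning
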